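{- The Ross--Yong conjecture is false: there exist $n$, a permutation $w\in S_n$ and a weak composition $\gamma\in\mathbb{Z}_{\geq 0}^n$ such that $g_{w,\gamma}\neq \#\mathrm{KKoh}(w,\gamma)$.
   Context: Let $S_n$ be the symmetric group, $s_i$ the simple transposition swapping $i,i+1$, and $\ell$ the Coxeter length. Grid conventions: $[n]=\{1,\dots,n\}$; a box $(i,j)\in[n]\times[n]$ is in row $i$ and column $j$, with $(1,1)$ the northwest box and row indices increasing southward. For $P\subseteq[n]\times[n]$, its weight $\mathrm{wt}(P)\in\mathbb{Z}_{\geq0}^n$ has $\mathrm{wt}(P)_i=\#\{c:(i,c)\in P\}$. Pipe dreams: label box $(i,k)$ by $i+k-1$. For $P\subseteq[n]\times[n]$, $\mathrm{word}(P)=(i_1,\dots,i_j)$ records the labels of the boxes of $P$, reading each row from right to left, rows from top to bottom. In the 0-Hecke monoid (basis $e_u$, $u$ in a symmetric group large enough to contain all $s_{i}$ with $i\le 2n-1$), $e_u e_{s_i}=e_{us_i}$ if $\ell(us_i)>\ell(u)$ and $e_u$ otherwise. The Demazure product $\delta(P)$ is defined by $e_{s_{i_1}}\cdots e_{s_{i_j}}=e_{\delta(P)}$. For $w\in S_n$ (viewed in the larger symmetric group) set $g_{w,\gamma}=\#\{P\subseteq[n]\times[n]:\delta(P)=w,\ \mathrm{wt}(P)=\gamma\}$. (These are, up to sign $(-1)^{|\gamma|-\ell(w)}$, the coefficients of the Grothendieck polynomial $\mathfrak G_w$.) Diagrams: a labeled diagram is $D\subseteq[n]\times[n]$ with each box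 labeled either "black" or "ghost"; $\mathrm{wt}(D)_i$ is the number of boxes (of either label) in row $i$. The Rothe diagram of $w\in S_n$ is $D(w)=\{(i,j)\in[n]\times[n]: w_i>j \text{ and } w^{ -1}_j>i\}$. Suppose $(i,j)\in D$ is the rightmost box of $D$ in row $i$ and is labeled black, let $i'=\max\{r\in[i]:(r,j)\notin D\}$ (required to exist), and suppose every box $(r,j)$ with $i'+1\le r\le i$ is labeled black. Then the Kohnert move at $(i,j)$ outputs $D\setminus\{(i,j)\}\cup\{(i',j)\}$ with the new box labeled black, and the K-Kohnert move at $(i,j)$ outputs $D\cup\{(i',j)\}$ with $(i',j)$ labeled black and $(i,j)$ relabeled ghost. $\mathrm{KKoh}(D)$ is the set of all labeled diagrams obtainable from $D$ (with all boxes initially black) by successive Kohnert and K-Kohnert moves (including $D$ itself), and $\mathrm{KKoh}(w,\gamma)=\{D\in\mathrm{KKoh}(D(w)):\mathrm{wt}(D)=\gamma\}$. The Ross--Yong conjecture asserts $g_{w,\gamma}=\#\mathrm{KKoh}(w,\gamma)$ for all $n$, $w\in S_n$, $\gamma\in\mathbb{Z}_{\ge0}^n$. -}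

module Defs where

open import Data.Nat using (ℕ; zero; suc; _+_; _*_; _<_; _≤_; _<ᵇ_)
open import Data.Bool using (Bool; true; false; if_then_else_)
open import Data.Fin using (Fin; toℕ)
open import Data.Fin.Permutation using (Permutation′; _⟨$⟩ʳ_; _⟨$⟩ˡ_)
open import Data.List using (List; []; _∷_; _++_; map; concat; reverse; foldl; length; upTo; allFin)
open import Data.Vec using (Vec; lookup; tabulate; toList; _[_]≔_)
open import Data.Product using (Σ; _×_)
open import Data.List.Relation.Unary.Unique.Propositional using (Unique)
open import Data.List.Membership.Propositional using (_∈_)
open import Relation.Binary.PropositionalEquality using (_≡_)
open import Function.Bundles using (_⇔_)

HasSize : {A : Set} → (A → Set) → ℕ → Set
HasSize {A} P k = Σ (List A) λ L → Unique L × ((x : A) → (x ∈ L) ⇔ P x) × (length L ≡ k)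

-- Permutations of the large symmetric group, in one-line notation,
-- values 0-indexed: a list u = (u(1),...,u(M)) of the numbers 0..M-1.

countGreater : ℕ → List ℕ → ℕ
countGreater x [] = 0
countGreater x (y ∷ ys) = if y <ᵇ x then suc (countGreater x ys) else countGreater x ys

-- Coxeter length = number of inversions
ℓ : List ℕ → ℕ
ℓ [] = 0
ℓ (x ∷ xs) = countGreater x xs + ℓ xs

swapAt : ℕ → List ℕ → List ℕ
swapAt zero (x ∷ y ∷ r) = y ∷ x ∷ r
swapAt (suc k) (x ∷ r) = x ∷ swapAt k r
swapAt _ l = l

-- right multiplication u ↦ u s_i (i 1-indexed, i ≥ 1): swaps positions i, i+1
mulS : List ℕ → ℕ → List ℕ
mulS u zero = u
mulS u (suc k) = swapAt k u

heckeStep : List ℕ → ℕ → List ℕ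
heckeStep u i = if ℓ u <ᵇ ℓ (mulS u i) then mulS u i else u

idPerm : ℕ → List ℕ
idPerm M = upTo M

demazure : ℕ → List ℕ → List ℕ
demazure M word = foldl heckeStep (idPerm M) word

-- Pipe dreams: subsets P of [n]×[n], as Boolean grids (row i, column k).

BoolGrid : ℕ → Set
BoolGrid n = Vec (Vec Bool n) n

countTrue : {m : ℕ} → Vec Bool m → ℕ
countTrue v = length (Data.List.filterᵇ (λ b → b) (toList v))

wtP : {n : ℕ} → BoolGrid n → Vec ℕ n
wtP P = Data.Vec.map countTrue P

-- word(P): rows top to bottom, each row right to left; box (i,k)
-- (1-indexed) has label i+k-1, i.e. i+k+1 for 0-indexed Fin positions.
rowWord : {n : ℕ} → Fin n → Vec Bool n → List ℕ
rowWord {n} i row =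
  concat (map (λ k → if lookup row k then (toℕ i + toℕ k + 1 ∷ []) else [])
              (reverse (allFin n)))

word : {n : ℕ} → BoolGrid n → List ℕ
word {n} P = concat (map (λ i → rowWord i (lookup P i)) (allFin n))

-- δ(P), computed in S_{2n} (which contains all s_i, i ≤ 2n-1)
δ : {n : ℕ} → BoolGrid n → List ℕ
δ {n} P = demazure (2 * n) (word P)

embed : {n : ℕ} → Permutation′ n → List ℕ
embed {n} w = map (λ i → toℕ (w ⟨$⟩ʳ i)) (allFin n) ++ map (n +_) (upTo n)

PipeDream : {n : ℕ} → Permutation′ n → Vec ℕ n → BoolGrid n → Set
PipeDream w γ P = (δ P ≡ embed w) × (wtP P ≡ γ)

data Cell : Set where
  empty black ghost : Cell

LGrid : ℕ → Set
LGrid n = Vec (Vec Cell n) n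

cellAt : {n : ℕ} → LGrid n → Fin n → Fin n → Cell
cellAt D i j = lookup (lookup D i) j

setCell : {n : ℕ} → LGrid n → Fin n → Fin n → Cell → LGrid n
setCell D i j c = D [ i ]≔ (lookup D i [ j ]≔ c)

isBox : Cell → Bool
isBox empty = false
isBox black = true
isBox ghost = true

wtD : {n : ℕ} → LGrid n → Vec ℕ n
wtD D = Data.Vec.map (λ row → length (Data.List.filterᵇ isBox (toList row))) D

-- Rothe diagram D(w) = {(i,j) : w_i > j and w⁻¹_j > i}, all boxes black
-- (strict comparisons are invariant under the 0-/1-index shift)
rothe : {n : ℕ} → Permutation′ n → LGrid n
rothe w = tabulate λ i → tabulate λ j →
  if (toℕ j <ᵇ toℕ (w ⟨$⟩ʳ i)) Data.Bool.∧ (toℕ i <ᵇ toℕ (w ⟨$⟩ˡ j)) then black else empty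

-- Move data at (i,j) with target row i' :
--  (i,j) is the rightmost box of row i and is black;
--  i' < i, (i',j) ∉ D and every (r,j), i' < r ≤ i, is black
--  (so i' = max{r ∈ [i] : (r,j) ∉ D}).
record MoveSite {n : ℕ} (D : LGrid n) (i j i' : Fin n) : Set where
  field
    isBlack   : cellAt D i j ≡ black
    rightmost : (c : Fin n) → toℕ j < toℕ c → cellAt D i c ≡ empty
    above     : toℕ i' < toℕ i
    gap       : cellAt D i' j ≡ empty
    between   : (r : Fin n) → toℕ i' < toℕ r → toℕ r ≤ toℕ i → cellAt D r j ≡ black

kohnert : {n : ℕ} → LGrid n → Fin n → Fin n → Fin n → LGrid n
kohnert D i j i' = setCell (setCell D i j empty) i' j black

kkohnert : {n : ℕ} → LGrid n → Fin n → Fin n → Fin n → LGrid n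
kkohnert D i j i' = setCell (setCell D i j ghost) i' j black

data KKoh {n : ℕ} (D₀ : LGrid n) : LGrid n → Set where
  base : KKoh D₀ D₀
  kMove : ∀ {D} i j i' → KKoh D₀ D → MoveSite D i j i' → KKoh D₀ (kohnert D i j i')
  kkMove : ∀ {D} i j i' → KKoh D₀ D → MoveSite D i j i' → KKoh D₀ (kkohnert D i j i')

KKohWt : {n : ℕ} → Permutation′ n → Vec ℕ n → LGrid n → Set
KKohWt w γ D = KKoh (rothe w) D × (wtD D ≡ γ)

-- With w = 12365847 ∈ S₈ and γ = (1,2,2,1,0,0,0,0) both sides are finite and are counted
-- by exhaustive enumeration: there are 16 pipe dreams but only 15 K-Kohnert diagrams.
--
-- Membership in the parabolic subgroup S_m × S_{2n-m} passes from a
-- Demazure product u·e_{s_i} back to u, while u·e_{s_m} never lies in it, since it has a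
-- descent at m.  The embedding of w ∈ S_n lies in S_m × S_{2n-m} for every m ≥ n, so a
-- pipe dream for w uses no label m ≥ n: it lives in the staircase i + k - 1 < n, where
-- there are only finitely many grids of weight γ.
--
-- No move decreases the number of boxes, so a diagram of weight γ
-- is reached through diagrams with at most |γ| boxes.  A search collects such diagrams
-- together with their derivations; a check that the collection is closed under every
-- move staying within |γ| boxes then shows that it contains all of them.

module Submission where

open import Defs
open import Data.Bool using (Bool; true; false; T; _∧_; _∨_; not; if_then_else_)
import Data.Bool.Properties as Bool
open import Data.Bool.ListAction using (all)
open import Data.Empty using (⊥-elim)
open import Data.Fin using (Fin; toℕ; zero; suc)
open import Data.Fin.Patterns using (0F; 1F; 2F; 3F; 4F; 5F; 6F; 7F)
open import Data.Fin.Permutation using (Permutation′; permutation; _⟨$⟩ʳ_)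
open import Data.Fin.Properties using (toℕ<n; all?) renaming (_≟_ to _≟ᶠ_)
open import Data.List
  using (List; []; _∷_; _++_; [_]; map; concatMap; foldl; foldr; length; applyUpTo;
         allFin; filter; filterᵇ; deduplicate; cartesianProduct; cartesianProductWith)
import Data.List.Properties as List
open import Data.List.Properties using (foldl-++; length-map; length-tabulate; map-applyUpTo; length-upTo)
open import Data.List.Membership.Propositional using (_∈_; _∉_; lose)
open import Data.List.Membership.Propositional.Properties
  using (∈-map⁺; ∈-map⁻; ∈-++⁺ˡ; ∈-++⁺ʳ; ∈-∃++; ∈-allFin; ∈-concat⁺′; ∈-concatMap⁺; ∈-cartesianProduct⁺;
         ∈-cartesianProductWith⁺; ∈-filter⁺; ∈-filter⁻; ∈-deduplicate⁺; ∈-deduplicate⁻)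
open import Data.List.Relation.Unary.All using (All; []; _∷_; universal)
import Data.List.Relation.Unary.All as All
import Data.List.Relation.Unary.All.Properties as All
open import Data.List.Relation.Unary.Any using (Any; here; there)
import Data.List.Relation.Unary.Any as Any
import Data.List.Relation.Unary.Any.Properties as Any
open import Data.List.Relation.Unary.Unique.DecPropositional.Properties using (deduplicate-!)
open import Data.Nat using (ℕ; zero; suc; _+_; _*_; _≤_; _<_; _<ᵇ_; _≤ᵇ_; _≡ᵇ_; s≤s; z≤n)
open import Data.Nat.DivMod using (_%_)
open import Data.Nat.Properties
open import Algebra.Properties.CommutativeSemigroup +-commutativeSemigroup using (x∙yz≈y∙xz; xy∙z≈xz∙y)
open import Data.Product using (Σ; ∃; ∃₂; _×_; _,_; proj₁; proj₂; map₁)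
open import Data.Sum using (_⊎_; inj₁; inj₂)
open import Data.Unit using (⊤; tt)
open import Data.Vec using (Vec; []; _∷_; lookup; toList; _[_]≔_)
import Data.Vec as Vec
import Data.Vec.Properties as Vec
open import Function using (_∘_; id)
open import Function.Bundles using (_⇔_; mk⇔; Equivalence)
open import Function.Construct.Composition using (_⇔-∘_)
open import Function.Construct.Identity using (⇔-id)
open import Function.Construct.Symmetry using (⇔-sym)
open import Relation.Binary.Definitions using (DecidableEquality)
open import Relation.Binary.PropositionalEquality
  using (_≡_; _≢_; refl; sym; trans; cong; cong₂; subst; module ≡-Reasoning)
open import Relation.Nullary using (¬_; Dec; yes; no; does; contradiction)
open import Relation.Nullary.Decidable using (map′; _×-dec_; _→-dec_; isYes; toWitness; dec-true)
open import Relation.Unary using (Decidable)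

hasSize-deduplicate : {A : Set} {P : A → Set} (_≟_ : DecidableEquality A) (xs : List A) →
  (∀ {x} → x ∈ xs → P x) → (∀ {x} → P x → x ∈ xs) → HasSize P (length (deduplicate _≟_ xs))
hasSize-deduplicate _≟_ xs sound complete =
  deduplicate _≟_ xs , deduplicate-! _≟_ xs ,
  (λ x → mk⇔ (sound ∘ ∈-deduplicate⁻ _≟_ xs) (∈-deduplicate⁺ _≟_ ∘ complete)) , refl

-- Demazure products and parabolic subgroups

data Adjacent : ℕ → ℕ → ℕ → List ℕ → Set where
  here  : ∀ {a b r} → Adjacent 0 a b (a ∷ b ∷ r)
  there : ∀ {k a b x r} → Adjacent k a b r → Adjacent (suc k) a b (x ∷ r)

swapAt-adjacent : ∀ {k a b u} → Adjacent k a b u → Adjacent k b a (swapAt k u)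
swapAt-adjacent here      = here
swapAt-adjacent (there h) = there (swapAt-adjacent h)

swapAt-involutive : ∀ {k a b u} → Adjacent k a b u → swapAt k (swapAt k u) ≡ u
swapAt-involutive here              = refl
swapAt-involutive (there {x = x} h) = cong (x ∷_) (swapAt-involutive h)

swapAt-equal : ∀ {k a u} → Adjacent k a a u → swapAt k u ≡ u
swapAt-equal here              = refl
swapAt-equal (there {x = x} h) = cong (x ∷_) (swapAt-equal h)

adjacent-or-swapAt-id : ∀ k u → (∃₂ λ a b → Adjacent k a b u) ⊎ swapAt k u ≡ u
adjacent-or-swapAt-id zero    []            = inj₂ refl
adjacent-or-swapAt-id zero    (x ∷ [])      = inj₂ refl
adjacent-or-swapAt-id zero    (x ∷ y ∷ r)   = inj₁ (x , y , here)
adjacent-or-swapAt-id (suc k) []            = inj₂ refl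
adjacent-or-swapAt-id (suc k) (x ∷ r) with adjacent-or-swapAt-id k r
... | inj₁ (a , b , h) = inj₁ (a , b , there h)
... | inj₂ e           = inj₂ (cong (x ∷_) e)

adjacent-exists : ∀ k u → suc k < length u → ∃₂ λ a b → Adjacent k a b u
adjacent-exists zero    (x ∷ y ∷ r) _            = x , y , here
adjacent-exists zero    (x ∷ [])    (s≤s ())
adjacent-exists (suc k) (x ∷ r)     (s≤s k<∣r∣) with adjacent-exists k r k<∣r∣
... | a , b , h = a , b , there h

length-swapAt : ∀ k u → length (swapAt k u) ≡ length u
length-swapAt zero    []          = refl
length-swapAt zero    (x ∷ [])    = refl
length-swapAt zero    (x ∷ y ∷ r) = refl
length-swapAt (suc k) []          = refl
length-swapAt (suc k) (x ∷ r)     = cong suc (length-swapAt k r)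

countGreater-swapAt : ∀ x k u → countGreater x (swapAt k u) ≡ countGreater x u
countGreater-swapAt x zero    []          = refl
countGreater-swapAt x zero    (a ∷ [])    = refl
countGreater-swapAt x zero    (a ∷ b ∷ r) with a <ᵇ x | b <ᵇ x
... | true  | true  = refl
... | true  | false = refl
... | false | true  = refl
... | false | false = refl
countGreater-swapAt x (suc k) []      = refl
countGreater-swapAt x (suc k) (a ∷ r) with a <ᵇ x
... | true  = cong suc (countGreater-swapAt x k r)
... | false = countGreater-swapAt x k r

countGreater-< : ∀ {x a} r → a < x → countGreater x (a ∷ r) ≡ suc (countGreater x r)
countGreater-< {x} {a} r a<x with a <ᵇ x | <⇒<ᵇ a<x
... | true | _ = refl

countGreater-≮ : ∀ {x a} r → ¬ a < x → countGreater x (a ∷ r) ≡ countGreater x r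
countGreater-≮ {x} {a} r a≮x with a <ᵇ x | <ᵇ⇒< a x
... | true  | a<x = contradiction (a<x _) a≮x
... | false | _   = refl

ℓ-swapAt-ascent : ∀ {k a b u} → Adjacent k a b u → a < b → ℓ (swapAt k u) ≡ suc (ℓ u)
ℓ-swapAt-ascent {a = a} {b} (here {r = r}) a<b = begin
  countGreater b (a ∷ r) + (countGreater a r + ℓ r)      ≡⟨ cong (_+ _) (countGreater-< r a<b) ⟩
  suc (countGreater b r + (countGreater a r + ℓ r))      ≡⟨ cong suc (x∙yz≈y∙xz (countGreater b r) (countGreater a r) (ℓ r)) ⟩
  suc (countGreater a r + (countGreater b r + ℓ r))      ≡⟨ cong (λ c → suc (c + _)) (countGreater-≮ r (<-asym a<b)) ⟨
  suc (countGreater a (b ∷ r) + (countGreater b r + ℓ r)) ∎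
  where open ≡-Reasoning
ℓ-swapAt-ascent {k = suc k} (there {x = x} {r = r} h) a<b = begin
  countGreater x (swapAt k r) + ℓ (swapAt k r) ≡⟨ cong₂ _+_ (countGreater-swapAt x k r) (ℓ-swapAt-ascent h a<b) ⟩
  countGreater x r + suc (ℓ r)                 ≡⟨ +-suc (countGreater x r) (ℓ r) ⟩
  suc (countGreater x r + ℓ r)                 ∎
  where open ≡-Reasoning

heckeStep-ascent : ∀ {k a b u} → Adjacent k a b u → a < b → heckeStep u (suc k) ≡ swapAt k u
heckeStep-ascent {k} {u = u} h a<b
  with ℓ u <ᵇ ℓ (swapAt k u) | <⇒<ᵇ (subst (ℓ u <_) (sym (ℓ-swapAt-ascent h a<b)) (n<1+n (ℓ u)))
... | true | _ = refl

ℓ-swapAt-descent : ∀ {k a b u} → Adjacent k a b u → b < a → ℓ u ≡ suc (ℓ (swapAt k u))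
ℓ-swapAt-descent h b<a = trans (cong ℓ (sym (swapAt-involutive h))) (ℓ-swapAt-ascent (swapAt-adjacent h) b<a)

heckeStep-nonascent : ∀ {k a b u} → Adjacent k a b u → b ≤ a → heckeStep u (suc k) ≡ u
heckeStep-nonascent {k} {u = u} h b≤a with ℓ u <ᵇ ℓ (swapAt k u) | <ᵇ⇒< (ℓ u) (ℓ (swapAt k u))
... | false | _ = refl
... | true  | ℓ-increases with m≤n⇒m<n∨m≡n b≤a
...   | inj₁ b<a  = ⊥-elim (<-asym (ℓ-increases _) (subst (ℓ (swapAt k u) <_) (sym (ℓ-swapAt-descent h b<a)) (n<1+n _)))
...   | inj₂ refl = ⊥-elim (<-irrefl (cong ℓ (sym (swapAt-equal h))) (ℓ-increases _))

heckeStep-descent : ∀ {k a b u} → Adjacent k a b u →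
  ∃₂ λ a′ b′ → Adjacent k a′ b′ (heckeStep u (suc k)) × b′ ≤ a′
heckeStep-descent {a = a} {b} h with a <? b
... | yes a<b = b , a , subst (Adjacent _ b a) (sym (heckeStep-ascent h a<b)) (swapAt-adjacent h) , <⇒≤ a<b
... | no  a≮b = a , b , subst (Adjacent _ a b) (sym (heckeStep-nonascent h (≮⇒≥ a≮b))) h , ≮⇒≥ a≮b

heckeStep-cases : ∀ u k → heckeStep u (suc k) ≡ swapAt k u ⊎ heckeStep u (suc k) ≡ u
heckeStep-cases u k with ℓ u <ᵇ ℓ (swapAt k u)
... | true  = inj₁ refl
... | false = inj₂ refl

length-heckeStep : ∀ u i → length (heckeStep u i) ≡ length u
length-heckeStep u zero with ℓ u <ᵇ ℓ u
... | true  = refl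
... | false = refl
length-heckeStep u (suc k) with heckeStep-cases u k
... | inj₁ e = trans (cong length e) (length-swapAt k u)
... | inj₂ e = cong length e

length-demazureFrom : ∀ u ws → length (foldl heckeStep u ws) ≡ length u
length-demazureFrom u []       = refl
length-demazureFrom u (i ∷ ws) = trans (length-demazureFrom (heckeStep u i) ws) (length-heckeStep u i)

SameSide : ℕ → ℕ → ℕ → Set
SameSide m p x = p < m ⇔ x < m

-- Parabolic m 0 u says that the permutation u of {0,…,M-1} lies in S_m × S_{M-m};
-- in general q is the position of the head of u.
Parabolic : ℕ → ℕ → List ℕ → Set
Parabolic m q []       = ⊤
Parabolic m q (x ∷ xs) = SameSide m q x × Parabolic m (suc q) xs

<⇔suc< : ∀ {q m} → suc q ≢ m → q < m ⇔ suc q < m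
<⇔suc< sq≢m = mk⇔ (λ q<m → ≤∧≢⇒< q<m sq≢m) (<-trans (n<1+n _))

sameSide-suc : ∀ {m q x} → suc q ≢ m → SameSide m q x → SameSide m (suc q) x
sameSide-suc sq≢m s = s ⇔-∘ ⇔-sym (<⇔suc< sq≢m)

sameSide-pred : ∀ {m q x} → suc q ≢ m → SameSide m (suc q) x → SameSide m q x
sameSide-pred sq≢m s = s ⇔-∘ <⇔suc< sq≢m

parabolic-swapAt⁻ : ∀ {m} q k u → suc (q + k) ≢ m → Parabolic m q (swapAt k u) → Parabolic m q u
parabolic-swapAt⁻ q zero    []          _  p = p
parabolic-swapAt⁻ q zero    (a ∷ [])    _  p = p
parabolic-swapAt⁻ q zero    (a ∷ b ∷ r) ne (sb , sa , p) = sameSide-pred sq≢m sa , sameSide-suc sq≢m sb , p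
  where sq≢m = λ e → ne (trans (cong suc (+-identityʳ q)) e)
parabolic-swapAt⁻ q (suc k) []          _  p = p
parabolic-swapAt⁻ q (suc k) (x ∷ r)     ne (s , p) =
  s , parabolic-swapAt⁻ (suc q) k r (λ e → ne (trans (cong suc (+-suc q k)) e)) p

parabolic-ascent : ∀ {m q k a b u} → suc (q + k) ≡ m → Adjacent k a b u → Parabolic m q u → a < b
parabolic-ascent {q = q} refl here (sa , sb , _) = <-≤-trans a<m (≮⇒≥ b≮m)
  where
  a<m = Equivalence.to sa (s≤s (m≤m+n q 0))
  b≮m = λ b<m → <-irrefl (cong suc (sym (+-identityʳ q))) (Equivalence.from sb b<m)
parabolic-ascent {q = q} {suc k} e (there h) (_ , p) = parabolic-ascent (trans (cong suc (sym (+-suc q k))) e) h p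

heckeStep-leaves-parabolic : ∀ {k a b u} → Adjacent k a b u → ¬ Parabolic (suc k) 0 (heckeStep u (suc k))
heckeStep-leaves-parabolic h p with heckeStep-descent h
... | a′ , b′ , h′ , b′≤a′ = <⇒≱ (parabolic-ascent refl h′ p) b′≤a′

parabolic-heckeStep⁻ : ∀ {m} u i → Parabolic m 0 (heckeStep u i) → Parabolic m 0 u
parabolic-heckeStep⁻ u zero p with ℓ u <ᵇ ℓ u
... | true  = p
... | false = p
parabolic-heckeStep⁻ {m} u (suc k) p with heckeStep-cases u k
... | inj₂ e = subst (Parabolic m 0) e p
... | inj₁ e with suc k ≟ m
...   | no sk≢m = parabolic-swapAt⁻ 0 k u sk≢m (subst (Parabolic m 0) e p)
...   | yes refl with adjacent-or-swapAt-id k u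
...     | inj₁ (_ , _ , h) = ⊥-elim (heckeStep-leaves-parabolic h p)
...     | inj₂ e′          = subst (Parabolic m 0) (trans e e′) p

parabolic-demazure⁻ : ∀ {m} u ws → Parabolic m 0 (foldl heckeStep u ws) → Parabolic m 0 u
parabolic-demazure⁻ u []       p = p
parabolic-demazure⁻ u (i ∷ ws) p = parabolic-heckeStep⁻ u i (parabolic-demazure⁻ (heckeStep u i) ws p)

letter-∉-parabolic : ∀ {k} u ws → suc k < length u → Parabolic (suc k) 0 (foldl heckeStep u ws) → suc k ∉ ws
letter-∉-parabolic {k} u ws k<∣u∣ p sk∈ws with ∈-∃++ sk∈ws
... | pre , post , refl = heckeStep-leaves-parabolic h (parabolic-demazure⁻ (heckeStep u′ (suc k)) post p′)
  where
  u′ = foldl heckeStep u pre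
  p′ = subst (Parabolic (suc k) 0) (foldl-++ heckeStep u pre (suc k ∷ post)) p
  h  = proj₂ (proj₂ (adjacent-exists k u′ (subst (suc k <_) (sym (length-demazureFrom u pre)) k<∣u∣)))

parabolic-++ : ∀ {m q} xs {ys} → Parabolic m q xs → Parabolic m (q + length xs) ys → Parabolic m q (xs ++ ys)
parabolic-++ {m} {q} []       _       p = subst (λ q′ → Parabolic m q′ _) (+-identityʳ q) p
parabolic-++ {m} {q} (x ∷ xs) {ys} (s , p) p′ =
  s , parabolic-++ xs p (subst (λ q′ → Parabolic m q′ ys) (+-suc q (length xs)) p′)

parabolic-below : ∀ {m q xs} → All (_< m) xs → q + length xs ≤ m → Parabolic m q xs
parabolic-below []                 _ = tt
parabolic-below {m} {q} {x ∷ xs} (x<m ∷ xs<m) bound =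
  mk⇔ (λ _ → x<m) (λ _ → <-≤-trans (s≤s (m≤m+n q (length xs))) bound′) , parabolic-below xs<m bound′
  where bound′ = subst (_≤ m) (+-suc q (length xs)) bound

parabolic-applyUpTo : ∀ {m q} f k → (∀ t → f t ≡ q + t) → Parabolic m q (applyUpTo f k)
parabolic-applyUpTo         f zero    _   = tt
parabolic-applyUpTo {m} {q} f (suc k) f≗q+ =
  subst (λ x → q < m ⇔ x < m) (sym (trans (f≗q+ 0) (+-identityʳ q))) (⇔-id _) ,
  parabolic-applyUpTo (f ∘ suc) k (λ t → trans (f≗q+ (suc t)) (+-suc q t))

embed-parabolic : ∀ {n m} (w : Permutation′ n) → n ≤ m → Parabolic m 0 (embed w)
embed-parabolic {n} {m} w n≤m =
  parabolic-++ values
    (parabolic-below (All.map⁺ (universal (λ i → <-≤-trans (toℕ<n (w ⟨$⟩ʳ i)) n≤m) _))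
                     (≤-trans (≤-reflexive ∣values∣≡n) n≤m))
    (subst (λ q → Parabolic m q _) (sym ∣values∣≡n)
      (subst (Parabolic m n) (sym (map-applyUpTo id (n +_) n)) (parabolic-applyUpTo (n +_) n (λ _ → refl))))
  where
  values = map (λ i → toℕ (w ⟨$⟩ʳ i)) (allFin n)
  ∣values∣≡n : length values ≡ n
  ∣values∣≡n = trans (length-map _ (allFin n)) (length-tabulate id)

-- Pipe dreams

word-∋-label : ∀ {n} (P : BoolGrid n) i c → lookup (lookup P i) c ≡ true → suc (toℕ i + toℕ c) ∈ word P
word-∋-label {n} P i c box =
  subst (_∈ word P) (+-comm _ 1) (∈-concat⁺′ (∈-concat⁺′ label∈ (∈-map⁺ entry (Any.reverse⁺ (∈-allFin c))))
                                             (∈-map⁺ (λ i → rowWord i (lookup P i)) (∈-allFin i)))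
  where
  entry : Fin n → List ℕ
  entry k = if lookup (lookup P i) k then toℕ i + toℕ k + 1 ∷ [] else []
  label∈ : toℕ i + toℕ c + 1 ∈ entry c
  label∈ rewrite box = here refl

label<2n : ∀ {n} (i c : Fin n) → suc (toℕ i + toℕ c) < length (idPerm (2 * n))
label<2n {n} i c = subst (suc (toℕ i + toℕ c) <_) (sym (trans (length-upTo (2 * n)) 2n≡n+n))
                         (subst (_≤ n + n) (+-suc (suc (toℕ i)) (toℕ c)) (+-mono-≤ (toℕ<n i) (toℕ<n c)))
  where 2n≡n+n = cong (n +_) (+-identityʳ n)

pipeDream-staircase : ∀ {n} (w : Permutation′ n) (P : BoolGrid n) → δ P ≡ embed w →
  ∀ i c → n ≤ toℕ i + toℕ c + 1 → lookup (lookup P i) c ≡ false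
pipeDream-staircase {n} w P δP≡w i c n≤label with lookup (lookup P i) c in box
... | false = refl
... | true  = ⊥-elim (letter-∉-parabolic (idPerm (2 * n)) (word P) (label<2n i c) parabolic (word-∋-label P i c box))
  where
  parabolic = subst (Parabolic _ 0) (sym δP≡w) (embed-parabolic w (subst (n ≤_) (+-comm _ 1) n≤label))

rowsWithin : (m b c : ℕ) → List (Vec Bool m)
rowsWithin zero    _       zero    = [] ∷ []
rowsWithin zero    _       (suc c) = []
rowsWithin (suc m) zero    c       = map (false ∷_) (rowsWithin m zero c)
rowsWithin (suc m) (suc b) zero    = map (false ∷_) (rowsWithin m b zero)
rowsWithin (suc m) (suc b) (suc c) = map (true ∷_) (rowsWithin m b c) ++ map (false ∷_) (rowsWithin m b (suc c))

∈-rowsWithin : ∀ {m} b {c} (v : Vec Bool m) → countTrue v ≡ c →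
  (∀ p → b ≤ toℕ p → lookup v p ≡ false) → v ∈ rowsWithin m b c
∈-rowsWithin _       []            refl _       = here refl
∈-rowsWithin zero    (true  ∷ v)   _    outside with () ← outside zero z≤n
∈-rowsWithin zero    (false ∷ v)   e    outside =
  ∈-map⁺ (false ∷_) (∈-rowsWithin zero v e (λ p _ → outside (suc p) z≤n))
∈-rowsWithin (suc b) (true  ∷ v)   refl outside =
  ∈-++⁺ˡ (∈-map⁺ (true ∷_) (∈-rowsWithin b v refl (λ p b≤p → outside (suc p) (s≤s b≤p))))
∈-rowsWithin (suc b) {zero}  (false ∷ v) e outside =
  ∈-map⁺ (false ∷_) (∈-rowsWithin b v e (λ p b≤p → outside (suc p) (s≤s b≤p)))
∈-rowsWithin (suc b) {suc c} (false ∷ v) e outside =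
  ∈-++⁺ʳ _ (∈-map⁺ (false ∷_) (∈-rowsWithin b v e (λ p b≤p → outside (suc p) (s≤s b≤p))))

-- Row i (from 0) of a grid with k rows may only use the columns c with i + c + 1 < k.
staircaseGrids : ∀ {k n} → Vec ℕ k → List (Vec (Vec Bool n) k)
staircaseGrids             []       = [] ∷ []
staircaseGrids {suc k} {n} (g ∷ γ) = cartesianProductWith _∷_ (rowsWithin n k g) (staircaseGrids γ)

∈-staircaseGrids : ∀ {k n} {γ : Vec ℕ k} (P : Vec (Vec Bool n) k) → Vec.map countTrue P ≡ γ →
  (∀ i c → k ≤ toℕ i + toℕ c + 1 → lookup (lookup P i) c ≡ false) → P ∈ staircaseGrids γ
∈-staircaseGrids {γ = []} [] refl _ = here refl
∈-staircaseGrids {suc k} {γ = g ∷ γ} (r ∷ P) wt outside = ∈-cartesianProductWith⁺ _∷_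
  (∈-rowsWithin k r (Vec.∷-injectiveˡ wt) (λ c k≤c → outside zero c (subst (suc k ≤_) (+-comm 1 (toℕ c)) (s≤s k≤c))))
  (∈-staircaseGrids P (Vec.∷-injectiveʳ wt) (λ i c k≤ → outside (suc i) c (s≤s k≤)))

_≟-grid_ : ∀ {n} → DecidableEquality (BoolGrid n)
_≟-grid_ = Vec.≡-dec (Vec.≡-dec Bool._≟_)

pipeDream? : ∀ {n} (w : Permutation′ n) γ → Decidable (PipeDream w γ)
pipeDream? w γ P = List.≡-dec _≟_ (δ P) (embed w) ×-dec Vec.≡-dec _≟_ (wtP P) γ

pipeDream-hasSize : ∀ {n} (w : Permutation′ n) γ →
  HasSize (PipeDream w γ) (length (deduplicate _≟-grid_ (filter (pipeDream? w γ) (staircaseGrids γ))))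
pipeDream-hasSize w γ = hasSize-deduplicate _≟-grid_ _ (proj₂ ∘ ∈-filter⁻ (pipeDream? w γ) {xs = staircaseGrids γ})
  λ {P} isPD@(δP≡w , wt) → ∈-filter⁺ (pipeDream? w γ) (∈-staircaseGrids P wt (pipeDream-staircase w P δP≡w)) isPD

-- K-Kohnert diagrams

_≟ᶜ_ : DecidableEquality Cell
empty ≟ᶜ empty = yes refl
black ≟ᶜ black = yes refl
ghost ≟ᶜ ghost = yes refl
empty ≟ᶜ black = no λ ()
empty ≟ᶜ ghost = no λ ()
black ≟ᶜ empty = no λ ()
black ≟ᶜ ghost = no λ ()
ghost ≟ᶜ empty = no λ ()
ghost ≟ᶜ black = no λ ()

_≟-diagram_ : ∀ {n} → DecidableEquality (LGrid n)
_≟-diagram_ = Vec.≡-dec (Vec.≡-dec _≟ᶜ_)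

Movable : ∀ {n} → LGrid n → Fin n → Fin n → Set
Movable D i j = cellAt D i j ≡ black × (∀ c → toℕ j < toℕ c → cellAt D i c ≡ empty)

movable? : ∀ {n} (D : LGrid n) i j → Dec (Movable D i j)
movable? D i j = cellAt D i j ≟ᶜ black ×-dec all? (λ c → toℕ j <? toℕ c →-dec cellAt D i c ≟ᶜ empty)

moveSite? : ∀ {n} (D : LGrid n) i j i′ → Dec (MoveSite D i j i′)
moveSite? D i j i′ = map′
  (λ ((isBlack , rightmost) , above , gap , between) → record
     { isBlack = isBlack ; rightmost = rightmost ; above = above ; gap = gap ; between = between })
  (λ s → let open MoveSite s in (isBlack , rightmost) , above , gap , between)
  (movable? D i j ×-dec toℕ i′ <? toℕ i ×-dec cellAt D i′ j ≟ᶜ empty ×-dec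
   all? (λ r → toℕ i′ <? toℕ r →-dec toℕ r ≤? toℕ i →-dec cellAt D r j ≟ᶜ black))

data Step {n} (D : LGrid n) : LGrid n → Set where
  kohnertStep  : ∀ {i j i′} → MoveSite D i j i′ → Step D (kohnert D i j i′)
  kkohnertStep : ∀ {i j i′} → MoveSite D i j i′ → Step D (kkohnert D i j i′)

KKoh-step : ∀ {n} {D₀ D E : LGrid n} → KKoh D₀ D → Step D E → KKoh D₀ E
KKoh-step r (kohnertStep  {i} {j} {i′} s) = kMove  i j i′ r s
KKoh-step r (kkohnertStep {i} {j} {i′} s) = kkMove i j i′ r s

movesFrom : ∀ {n} {D : LGrid n} {i j i′} → Dec (MoveSite D i j i′) → List (Σ (LGrid n) (Step D))
movesFrom {D = D} {i} {j} {i′} (yes s) = (kohnert D i j i′ , kohnertStep s) ∷ (kkohnert D i j i′ , kkohnertStep s) ∷ []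
movesFrom                      (no  _) = []

-- Testing movability of the box first is only an optimisation.
movesOfBox : ∀ {n} (D : LGrid n) → Fin n × Fin n → List (Σ (LGrid n) (Step D))
movesOfBox {n} D (i , j) =
  if does (movable? D i j) then concatMap (λ i′ → movesFrom (moveSite? D i j i′)) (allFin n) else []

steps : ∀ {n} (D : LGrid n) → List (Σ (LGrid n) (Step D))
steps {n} D = concatMap (movesOfBox D) (cartesianProduct (allFin n) (allFin n))

∈-movesFrom : ∀ {n} {D : LGrid n} {i j i′} → MoveSite D i j i′ → (d : Dec (MoveSite D i j i′)) →
  (∃ λ t → (kohnert D i j i′ , t) ∈ movesFrom d) × (∃ λ t → (kkohnert D i j i′ , t) ∈ movesFrom d)
∈-movesFrom _ (yes s) = (kohnertStep s , here refl) , (kkohnertStep s , there (here refl))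
∈-movesFrom s (no ¬s) = contradiction s ¬s

movesFrom-⊆-steps : ∀ {n} {D : LGrid n} {i j i′} → MoveSite D i j i′ →
  ∀ {x} → x ∈ movesFrom (moveSite? D i j i′) → x ∈ steps D
movesFrom-⊆-steps {n} {D} {i} {j} {i′} s x∈ =
  ∈-concatMap⁺ (movesOfBox D) (lose (∈-cartesianProduct⁺ (∈-allFin i) (∈-allFin j)) x∈box)
  where
  x∈box : _ ∈ movesOfBox D (i , j)
  x∈box rewrite dec-true (movable? D i j) (MoveSite.isBlack s , MoveSite.rightmost s) =
    ∈-concatMap⁺ (λ i′ → movesFrom (moveSite? D i j i′)) (lose (∈-allFin i′) x∈)

∈-steps : ∀ {n} {D E : LGrid n} → Step D E → ∃ λ t → (E , t) ∈ steps D
∈-steps {D = D} (kohnertStep {i} {j} {i′} s) with t , t∈ ← proj₁ (∈-movesFrom s (moveSite? D i j i′)) =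
  t , movesFrom-⊆-steps s t∈
∈-steps {D = D} (kkohnertStep {i} {j} {i′} s) with t , t∈ ← proj₂ (∈-movesFrom s (moveSite? D i j i′)) =
  t , movesFrom-⊆-steps s t∈

sum-[]≔ : ∀ {n} (v : Vec ℕ n) k x → Vec.sum (v [ k ]≔ x) + lookup v k ≡ Vec.sum v + x
sum-[]≔ (a Vec.∷ v) Fin.zero x = begin
  (x + Vec.sum v) + a ≡⟨ xy∙z≈xz∙y x (Vec.sum v) a ⟩
  (x + a) + Vec.sum v ≡⟨ cong (_+ Vec.sum v) (+-comm x a) ⟩
  (a + x) + Vec.sum v ≡⟨ xy∙z≈xz∙y a x (Vec.sum v) ⟩
  (a + Vec.sum v) + x ∎
  where open ≡-Reasoning
sum-[]≔ (a Vec.∷ v) (Fin.suc k) x = begin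
  (a + Vec.sum (v [ k ]≔ x)) + lookup v k ≡⟨ +-assoc a _ _ ⟩
  a + (Vec.sum (v [ k ]≔ x) + lookup v k) ≡⟨ cong (a +_) (sum-[]≔ v k x) ⟩
  a + (Vec.sum v + x)                     ≡⟨ +-assoc a _ _ ⟨
  (a + Vec.sum v) + x                     ∎
  where open ≡-Reasoning

boxN : Cell → ℕ
boxN empty = 0
boxN black = 1
boxN ghost = 1

rowCount : ∀ {n} → Vec Cell n → ℕ
rowCount row = length (filterᵇ isBox (toList row))

boxCount : ∀ {n} → LGrid n → ℕ
boxCount D = Vec.sum (wtD D)

rowCount-sum : ∀ {n} (row : Vec Cell n) → rowCount row ≡ Vec.sum (Vec.map boxN row)
rowCount-sum Vec.[]            = refl
rowCount-sum (empty Vec.∷ row) = rowCount-sum row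
rowCount-sum (black Vec.∷ row) = cong suc (rowCount-sum row)
rowCount-sum (ghost Vec.∷ row) = cong suc (rowCount-sum row)

rowCount-[]≔ : ∀ {n} (row : Vec Cell n) j c → rowCount (row [ j ]≔ c) + boxN (lookup row j) ≡ rowCount row + boxN c
rowCount-[]≔ row j c = begin
  rowCount (row [ j ]≔ c) + boxN (lookup row j)
    ≡⟨ cong₂ _+_ (trans (rowCount-sum (row [ j ]≔ c)) (cong Vec.sum (Vec.map-[]≔ boxN row j)))
                 (sym (Vec.lookup-map j boxN row)) ⟩
  Vec.sum (Vec.map boxN row [ j ]≔ boxN c) + lookup (Vec.map boxN row) j
    ≡⟨ sum-[]≔ (Vec.map boxN row) j (boxN c) ⟩
  Vec.sum (Vec.map boxN row) + boxN c
    ≡⟨ cong (_+ boxN c) (rowCount-sum row) ⟨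
  rowCount row + boxN c ∎
  where open ≡-Reasoning

boxCount-setCell : ∀ {n} (D : LGrid n) i j c → boxCount (setCell D i j c) + boxN (cellAt D i j) ≡ boxCount D + boxN c
boxCount-setCell D i j c = +-cancelʳ-≡ r _ _ (begin
  (S′ + o) + r ≡⟨ xy∙z≈xz∙y S′ o r ⟩
  (S′ + r) + o ≡⟨ cong (_+ o) outer ⟩
  (S + r′) + o ≡⟨ +-assoc S r′ o ⟩
  S + (r′ + o) ≡⟨ cong (S +_) (rowCount-[]≔ (lookup D i) j c) ⟩
  S + (r + c′) ≡⟨ +-assoc S r c′ ⟨
  (S + r) + c′ ≡⟨ xy∙z≈xz∙y S r c′ ⟩
  (S + c′) + r ∎)
  where
  open ≡-Reasoning
  R′ = lookup D i [ j ]≔ c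
  S′ = boxCount (setCell D i j c)
  S  = boxCount D
  r  = rowCount (lookup D i)
  r′ = rowCount R′
  o  = boxN (cellAt D i j)
  c′ = boxN c
  outer : S′ + r ≡ S + r′
  outer = trans (cong₂ _+_ (cong Vec.sum (Vec.map-[]≔ rowCount D i)) (sym (Vec.lookup-map i rowCount D)))
                (sum-[]≔ (wtD D) i r′)

boxCount-move : ∀ {n} {D : LGrid n} {i j i′} → MoveSite D i j i′ → ∀ c →
  boxCount (setCell (setCell D i j c) i′ j black) ≡ boxCount D + boxN c
boxCount-move {D = D} {i} {j} {i′} s c = begin
  boxCount D₂                       ≡⟨ +-identityʳ _ ⟨
  boxCount D₂ + boxN empty          ≡⟨ cong (λ x → boxCount D₂ + boxN x) gap′ ⟨
  boxCount D₂ + boxN (cellAt D₁ i′ j) ≡⟨ boxCount-setCell D₁ i′ j black ⟩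
  boxCount D₁ + 1                   ≡⟨ cong (λ x → boxCount D₁ + boxN x) (MoveSite.isBlack s) ⟨
  boxCount D₁ + boxN (cellAt D i j) ≡⟨ boxCount-setCell D i j c ⟩
  boxCount D + boxN c               ∎
  where
  open ≡-Reasoning
  D₁ = setCell D i j c
  D₂ = setCell D₁ i′ j black
  gap′ : cellAt D₁ i′ j ≡ empty
  gap′ = trans (cong (λ row → lookup row j) (Vec.lookup∘update′ i′≢i D _)) (MoveSite.gap s)
    where i′≢i = λ i′≡i → <-irrefl (cong toℕ i′≡i) (MoveSite.above s)

boxCount-step : ∀ {n} {D E : LGrid n} → Step D E → boxCount D ≤ boxCount E
boxCount-step (kohnertStep  s) = ≤-reflexive (sym (trans (boxCount-move s empty) (+-identityʳ _)))
boxCount-step (kkohnertStep s) = subst (_ ≤_) (sym (boxCount-move s ghost)) (m≤m+n _ 1)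

Closed : ∀ {n} → ℕ → List (LGrid n) → Set
Closed N Ds = ∀ {D E} → D ∈ Ds → Step D E → boxCount E ≤ N → E ∈ Ds

KKoh-∈-closed : ∀ {n N} {D₀ D : LGrid n} {Ds} → D₀ ∈ Ds → Closed N Ds → KKoh D₀ D → boxCount D ≤ N → D ∈ Ds
KKoh-∈-closed D₀∈ closed base                _ = D₀∈
KKoh-∈-closed D₀∈ closed (kMove  _ _ _ r s) bound =
  closed (KKoh-∈-closed D₀∈ closed r (≤-trans (boxCount-step (kohnertStep s)) bound)) (kohnertStep s) bound
KKoh-∈-closed D₀∈ closed (kkMove _ _ _ r s) bound =
  closed (KKoh-∈-closed D₀∈ closed r (≤-trans (boxCount-step (kkohnertStep s)) bound)) (kkohnertStep s) bound

hasWeight? : ∀ {n} (γ : Vec ℕ n) → Decidable (λ (D : LGrid n) → wtD D ≡ γ)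
hasWeight? γ D = Vec.≡-dec _≟_ (wtD D) γ

data Tree (A : Set) : Set where
  leaf : Tree A
  node : Tree A → ℕ → A → Tree A → Tree A

module _ {A : Set} where

  elements : Tree A → List A
  elements leaf           = []
  elements (node l _ x r) = elements l ++ x ∷ elements r

  insert : ℕ → A → Tree A → Tree A
  insert k x leaf = node leaf k x leaf
  insert k x (node l k′ y r) =
    if k <ᵇ k′ then node (insert k x l) k′ y r else node l k′ y (insert k x r)

  anyAtKey : ℕ → (A → Bool) → Tree A → Bool
  anyAtKey k p leaf = false
  anyAtKey k p (node l k′ x r) =
    if k ≡ᵇ k′ then p x ∨ anyAtKey k p r else if k <ᵇ k′ then anyAtKey k p l else anyAtKey k p r

  anyAtKey-sound : ∀ {k p} t → T (anyAtKey k p t) → Any (T ∘ p) (elements t)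
  anyAtKey-sound {k} {p} (node l k′ x r) found with k ≡ᵇ k′ | k <ᵇ k′
  ... | false | true  = Any.++⁺ˡ (anyAtKey-sound l found)
  ... | false | false = Any.++⁺ʳ (elements l) (there (anyAtKey-sound r found))
  ... | true  | _ with Equivalence.to (Bool.T-∨ {p x}) found
  ...   | inj₁ px    = Any.++⁺ʳ (elements l) (here px)
  ...   | inj₂ found′ = Any.++⁺ʳ (elements l) (there (anyAtKey-sound r found′))

cellDigit : Cell → ℕ
cellDigit empty = 0
cellDigit black = 1
cellDigit ghost = 2

code : ∀ {n} → LGrid n → ℕ
code D = foldr (λ c k → cellDigit c + 3 * k) 0 (concatMap toList (toList D))

-- Only keeps the search trees balanced: a collision merely costs time.
hash : ∀ {n} → LGrid n → ℕ
hash D = (code D * 2654435761) % 4294967296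

module Exploration {n} (D₀ : LGrid n) where

  Reached : Set
  Reached = Σ (LGrid n) (KKoh D₀)

  memberᵇ : LGrid n → Tree Reached → Bool
  memberᵇ E = anyAtKey (hash E) (λ x → isYes (proj₁ x ≟-diagram E))

  memberᵇ-sound : ∀ {E} t → T (memberᵇ E t) → E ∈ map proj₁ (elements t)
  memberᵇ-sound t found = Any.map⁺ (Any.map (λ same → sym (toWitness same)) (anyAtKey-sound t found))

  reached⇒KKoh : ∀ {E} (xs : List Reached) → E ∈ map proj₁ xs → KKoh D₀ E
  reached⇒KKoh xs E∈ with (_ , r) , _ , refl ← ∈-map⁻ proj₁ E∈ = r

  successors : Reached → List Reached
  successors (D , r) = map (λ (E , s) → E , KKoh-step r s) (steps D)

  visit : ℕ → List Reached → Tree Reached → List Reached × Tree Reached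
  visit N []       seen = [] , seen
  visit N (x ∷ xs) seen =
    if (boxCount (proj₁ x) ≤ᵇ N) ∧ not (memberᵇ (proj₁ x) seen)
    then map₁ (x ∷_) (visit N xs (insert (hash (proj₁ x)) x seen))
    else visit N xs seen

  search : ℕ → ℕ → List Reached → Tree Reached → Tree Reached
  search N zero       _          seen = seen
  search N (suc fuel) []         seen = seen
  search N (suc fuel) (x ∷ todo) seen with visit N (successors x) seen
  ... | new , seen′ = search N fuel (new ++ todo) seen′

  -- Nothing is proved about the search: its result is certified by closedᵇ.
  reachable : ℕ → ℕ → Tree Reached
  reachable N fuel = search N fuel [ D₀ , base ] (insert (hash D₀) (D₀ , base) leaf)

  closedᵇ : ℕ → Tree Reached → Bool
  closedᵇ N t = all (λ x → all (λ (E , _) → (N <ᵇ boxCount E) ∨ memberᵇ E t) (steps (proj₁ x))) (elements t)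

  closedᵇ-sound : ∀ {N} t → T (closedᵇ N t) → Closed N (map proj₁ (elements t))
  closedᵇ-sound {N} t ok D∈ step bound with (D , _) , x∈ , refl ← ∈-map⁻ proj₁ D∈ | s , E∈ ← ∈-steps step
    with Equivalence.to Bool.T-∨ (All.lookup (All.all⁺ _ _ (All.lookup (All.all⁺ _ _ ok) x∈)) E∈)
  ... | inj₁ N<E  = contradiction (<ᵇ⇒< _ _ N<E) (≤⇒≯ bound)
  ... | inj₂ E∈t  = memberᵇ-sound t E∈t

  weighted : Vec ℕ n → Tree Reached → List (LGrid n)
  weighted γ t = deduplicate _≟-diagram_ (filter (hasWeight? γ) (map proj₁ (elements t)))

  -- A single test, so that the search result t is evaluated only once.
  certifiesᵇ : Vec ℕ n → ℕ → Tree Reached → Bool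
  certifiesᵇ γ k t = memberᵇ D₀ t ∧ closedᵇ (Vec.sum γ) t ∧ (length (weighted γ t) ≡ᵇ k)

  kkoh-hasSize : ∀ γ k t → certifiesᵇ γ k t ≡ true → HasSize (λ D → KKoh D₀ D × wtD D ≡ γ) k
  kkoh-hasSize γ k t certified with Equivalence.to Bool.T-∧ (Equivalence.from Bool.T-≡ certified)
  ... | D₀∈t , closed∧count with Equivalence.to Bool.T-∧ closed∧count
  ...   | closed , count = subst (HasSize _) (≡ᵇ⇒≡ _ k count) (hasSize-deduplicate _≟-diagram_ _
    (λ D∈ → let D∈t , wt = ∈-filter⁻ (hasWeight? γ) {xs = map proj₁ (elements t)} D∈ in reached⇒KKoh (elements t) D∈t , wt)
    (λ (r , wt) → ∈-filter⁺ (hasWeight? γ) (KKoh-∈-closed D₀∈Ds (closedᵇ-sound t closed) r (≤-reflexive (cong Vec.sum wt))) wt))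
    where D₀∈Ds = memberᵇ-sound t D₀∈t

w₀ : Permutation′ 8
w₀ = permutation w w⁻¹ (toWitness {a? = all? λ i → w (w⁻¹ i) ≟ᶠ i} _)
                       (toWitness {a? = all? λ i → w⁻¹ (w i) ≟ᶠ i} _)
  where
  w w⁻¹ : Fin 8 → Fin 8
  w   = lookup (0F ∷ 1F ∷ 2F ∷ 5F ∷ 4F ∷ 7F ∷ 3F ∷ 6F ∷ [])
  w⁻¹ = lookup (0F ∷ 1F ∷ 2F ∷ 6F ∷ 4F ∷ 3F ∷ 7F ∷ 5F ∷ [])

γ₀ : Vec ℕ 8
γ₀ = 1 ∷ 2 ∷ 2 ∷ 1 ∷ 0 ∷ 0 ∷ 0 ∷ 0 ∷ []

pipeDreams-w₀ : HasSize (PipeDream w₀ γ₀) 16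
pipeDreams-w₀ = pipeDream-hasSize w₀ γ₀

-- 6 = |γ₀|, and the fuel exceeds the 2181 diagrams found with at most 6 boxes.
kkohnertDiagrams-w₀ : HasSize (KKohWt w₀ γ₀) 15
kkohnertDiagrams-w₀ = kkoh-hasSize γ₀ 15 (reachable 6 5000) refl
  where open Exploration (rothe w₀)

claim3p4 : Σ ℕ λ n → Σ (Permutation′ n) λ w → Σ (Vec ℕ n) λ γ → Σ ℕ λ g → Σ ℕ λ k →
    HasSize (PipeDream w γ) g × HasSize (KKohWt w γ) k × (g ≢ k)
claim3p4 = 8 , w₀ , γ₀ , 16 , 15 , pipeDreams-w₀ , kkohnertDiagrams-w₀ , λ ()
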